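{- Let $\alpha$ be a nondegenerate $d$-simplex in the $d$-cube and $\sigma$ an exterior face of $\alpha$. Then the projection $\pi_\sigma$ along $\sigma$ is one-to-one on the set of vertices of $\alpha$ that are not vertices of $\sigma$.
   Context: A nondegenerate $d$-simplex in the $d$-cube is the convex hull of $d+1$ affinely independent points of $\{0,1\}^d$. A $j$-face of the cube $[0,1]^d$ is obtained by fixing $d-j$ specified coordinates to specified values in $\{0,1\}$. A $j$-face of a simplex is the convex hull of $j+1$ of its vertices; it is exterior if it is contained in some $j$-face of the cube. For an exterior face $\sigma$, let $S_\sigma$ be the set of coordinates on which the vertices of $\sigma$ are not all equal. The projection along $\sigma$ is the map $\pi_\sigma:[0,1]^d\to[0,1]^d$ that replaces every coordinate with index in $S_\sigma$ by $0$ and leaves the other coordinates unchanged (it collapses $\sigma$ to a single point). -}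

module Defs where

open import Data.Nat using (ℕ; zero; suc; _+_)
open import Data.Bool using (Bool; true; false; if_then_else_; _∧_; _∨_; not)
open import Data.Fin using (Fin; zero; suc)
open import Data.Fin.Subset using (Subset; _∈_; _∉_; ∣_∣)
open import Data.Rational using (ℚ; 0ℚ; 1ℚ; _*_) renaming (_+_ to _+ℚ_)
open import Data.Product using (Σ; ∃; _×_)
open import Relation.Binary.PropositionalEquality using (_≡_)
open import Data.Vec using (lookup)

-- A point of {0,1}^d (vertex of the d-cube): true = 1, false = 0.
Point : ℕ → Set
Point d = Fin d → Bool

sumℚ : ∀ {n} → (Fin n → ℚ) → ℚ
sumℚ {zero}  f = 0ℚ
sumℚ {suc n} f = f zero +ℚ sumℚ (λ k → f (suc k))

anyFin : ∀ {n} → (Fin n → Bool) → Bool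
anyFin {zero}  f = false
anyFin {suc n} f = f zero ∨ anyFin (λ k → f (suc k))

bit : Bool → ℚ
bit true  = 1ℚ
bit false = 0ℚ

AffinelyIndependent : ∀ {m d} → (Fin m → Point d) → Set
AffinelyIndependent {m} {d} v =
  (λ′ : Fin m → ℚ) →
  sumℚ λ′ ≡ 0ℚ →
  (∀ (i : Fin d) → sumℚ (λ k → λ′ k * bit (v k i)) ≡ 0ℚ) →
  ∀ k → λ′ k ≡ 0ℚ

NondegenerateSimplex : (d : ℕ) → (Fin (suc d) → Point d) → Set
NondegenerateSimplex d v = AffinelyIndependent v

IsFace : ∀ {d} → ℕ → Subset (suc d) → Set
IsFace j σ = ∣ σ ∣ ≡ suc j

-- The j-face σ is exterior: it is contained in some j-face of the cube,
-- i.e. there are a set T of d-j coordinates and values b such that every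
-- the cube face {x | x_i = b_i for i ∈ T} contains σ.
-- (The cube face is convex, so containing conv(σ) = containing σ's vertices.)
IsExterior : ∀ {d} → (Fin (suc d) → Point d) → ℕ → Subset (suc d) → Set
IsExterior {d} v j σ =
  Σ (Subset d) λ T → (∣ T ∣ + j ≡ d) ×
  Σ (Point d) λ b → ∀ k → k ∈ σ → ∀ i → i ∈ T → v k i ≡ b i

-- S_σ as a Boolean predicate on coordinates: i ∈ S_σ iff the vertices of σ
-- are not all equal on coordinate i (some has 1 and some has 0).
inS : ∀ {d} → (Fin (suc d) → Point d) → Subset (suc d) → Fin d → Bool
inS v σ i = anyFin (λ k → lookup σ k ∧ v k i) ∧ anyFin (λ k → lookup σ k ∧ not (v k i))

-- The projection π_σ along σ (restricted to cube points): coordinates in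
-- S_σ are replaced by 0, the others are kept.
proj : ∀ {d} → (Fin (suc d) → Point d) → Subset (suc d) → Point d → Point d
proj v σ x i = if inS v σ i then false else x i

{-# OPTIONS --safe #-}
module Submission where

-- Suppose k ≠ l are vertices off σ with π_σ(v_k) = π_σ(v_l). Let T be the d − j coordinates
-- fixed (to b) on σ; they lie outside S_σ, so v_k and v_l agree on T. The d homogeneous
-- equations  Σ λ = 0,  Σ_{q ∉ σ} λ_q = 0,  λ_p = 0 for the other d − j − 2 vertices p off σ,
-- and  Σ_q λ_q v_q,i = 0 for the j coordinates i ∉ T  have a nonzero solution λ ∈ ℚ^{d+1}
-- (Gaussian elimination). For i ∈ T the only vertices off σ with nonzero weight are v_k and
-- v_l, which share the value v_k,i, so  Σ_q λ_q v_q,i = b_i Σ λ + (v_k,i − b_i) Σ_{q ∉ σ} λ_q = 0.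
-- Thus λ is a nontrivial affine dependence among the vertices, contradicting nondegeneracy.

open import Defs
open import Algebra.Bundles using (CommutativeRing)
open import Data.Bool using (Bool; true; false; not; _∧_; if_then_else_)
open import Data.Bool.Properties using (∧-zeroʳ)
open import Data.Fin using (Fin; zero; suc)
open import Data.Fin.Properties using () renaming (_≟_ to _≟ᶠ_)
open import Data.Fin.Subset using (Subset; inside; outside; _∈_; _∉_; ∣_∣)
open import Data.Fin.Subset.Properties using (_∈?_)
open import Data.List using (List; []; _∷_; length; map; _++_)
open import Data.List.Properties using (length-++; length-map; length-removeAt′)
open import Data.List.Relation.Unary.All as All using (All; _∷_)
open import Data.List.Relation.Unary.All.Properties using (¬Any⇒All¬; ─⁻; map⁻; ++⁻ˡ; ++⁻ʳ)
open import Data.List.Relation.Unary.Any as Any using (Any; any?; _─_)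
open import Data.List.Relation.Unary.Any.Properties using (lookup-result)
open import Data.Nat as ℕ using (ℕ; zero; suc; _≤_; s≤s⁻¹)
import Data.Nat.Properties as ℕₚ
open import Data.Product using (∃-syntax; _×_; _,_)
open import Data.Rational using (ℚ; 0ℚ; 1ℚ; _*_; _+_; _-_; -_; 1/_)
open import Data.Rational.Properties
  using ( _≟_; 1≢0; +-*-commutativeRing; *-comm; *-assoc; *-identityˡ; *-identityʳ
        ; *-zeroˡ; *-zeroʳ; *-inverseˡ; +-identityˡ; +-identityʳ)
open import Data.Rational.Base using (≢-nonZero)
open import Data.Rational.Solver using (module +-*-Solver)
open import Data.Vec using ([]; _∷_; lookup; here; there)
open import Data.Vec.Properties using (lookup⇒[]=; []=⇒lookup)
open import Data.Vec.Functional using (Vector; tail)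
open import Function using (_∘_)
open import Relation.Binary.PropositionalEquality
open import Relation.Nullary using (¬_; yes; no; ¬?; contradiction)
open import Relation.Nullary.Decidable using (decidable-stable)

open import Algebra.Properties.Semiring.Sum (CommutativeRing.semiring +-*-commutativeRing)
  using (sum; sum-cong-≗; ∑-distrib-+; *-distribˡ-sum; sum-replicate-zero)
open +-*-Solver using (solve; _:+_; _:*_; _:-_; :-_; _:=_; con)
open ≡-Reasoning

private variable
  n : ℕ

a*b≡0⇒b≡0 : ∀ {a b} → a ≢ 0ℚ → a * b ≡ 0ℚ → b ≡ 0ℚ
a*b≡0⇒b≡0 {a} {b} a≢0 ab≡0 = begin
  b              ≡⟨ sym (*-identityˡ b) ⟩
  1ℚ * b         ≡⟨ cong (_* b) (sym (*-inverseˡ a)) ⟩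
  1/ a * a * b   ≡⟨ *-assoc (1/ a) a b ⟩
  1/ a * (a * b) ≡⟨ cong (1/ a *_) ab≡0 ⟩
  1/ a * 0ℚ      ≡⟨ *-zeroʳ (1/ a) ⟩
  0ℚ             ∎
  where instance _ = ≢-nonZero a≢0

sumℚ≡sum : (f : Vector ℚ n) → sumℚ f ≡ sum f
sumℚ≡sum {zero}  f = refl
sumℚ≡sum {suc n} f = cong (f zero +_) (sumℚ≡sum (tail f))

infix 7 _·_
_·_ : Vector ℚ n → Vector ℚ n → ℚ
x · r = sum (λ u → x u * r u)

·-comm : (x r : Vector ℚ n) → x · r ≡ r · x
·-comm x r = sum-cong-≗ (λ u → *-comm (x u) (r u))

·-zeroʳ : (x : Vector ℚ n) → x · (λ _ → 0ℚ) ≡ 0ℚ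
·-zeroʳ {n} x = trans (sum-cong-≗ (λ u → *-zeroʳ (x u))) (sum-replicate-zero n)

·-scaleˡ : (a : ℚ) (x r : Vector ℚ n) → (λ u → a * x u) · r ≡ a * (x · r)
·-scaleˡ a x r = trans (sum-cong-≗ (λ u → *-assoc a (x u) (r u))) (sym (*-distribˡ-sum a (λ u → x u * r u)))

·-linear : (x : Vector ℚ n) (a : ℚ) (r : Vector ℚ n) (b : ℚ) (s : Vector ℚ n) →
           x · (λ u → a * r u + b * s u) ≡ a * (x · r) + b * (x · s)
·-linear x a r b s = begin
  x · (λ u → a * r u + b * s u)
    ≡⟨ sum-cong-≗ (λ u → distrib (x u) (r u) (s u)) ⟩
  sum (λ u → a * (x u * r u) + b * (x u * s u))
    ≡⟨ ∑-distrib-+ (λ u → a * (x u * r u)) (λ u → b * (x u * s u)) ⟩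
  sum (λ u → a * (x u * r u)) + sum (λ u → b * (x u * s u))
    ≡⟨ sym (cong₂ _+_ (*-distribˡ-sum a (λ u → x u * r u)) (*-distribˡ-sum b (λ u → x u * s u))) ⟩
  a * (x · r) + b * (x · s) ∎
  where
  distrib : ∀ y p q → y * (a * p + b * q) ≡ a * (y * p) + b * (y * q)
  distrib = solve 5 (λ a b y p q → y :* (a :* p :+ b :* q) := a :* (y :* p) :+ b :* (y :* q)) refl a b

δ : Fin n → Vector ℚ n
δ zero    zero    = 1ℚ
δ zero    (suc _) = 0ℚ
δ (suc _) zero    = 0ℚ
δ (suc p) (suc q) = δ p q

·-δ : (x : Vector ℚ n) (p : Fin n) → x · δ p ≡ x p
·-δ x zero = begin
  x zero * 1ℚ + tail x · (λ _ → 0ℚ) ≡⟨ cong₂ _+_ (*-identityʳ (x zero)) (·-zeroʳ (tail x)) ⟩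
  x zero + 0ℚ                        ≡⟨ +-identityʳ (x zero) ⟩
  x zero                             ∎
·-δ x (suc p) = begin
  x zero * 0ℚ + tail x · δ p ≡⟨ cong₂ _+_ (*-zeroʳ (x zero)) (·-δ (tail x) p) ⟩
  0ℚ + x (suc p)             ≡⟨ +-identityˡ (x (suc p)) ⟩
  x (suc p)                  ∎

eliminate : Vector ℚ (suc n) → Vector ℚ (suc n) → Vector ℚ n
eliminate r s u = r zero * s (suc u) + - s zero * r (suc u)

lift : Vector ℚ (suc n) → Vector ℚ n → Vector ℚ (suc n)
lift r μ zero    = - (μ · tail r)
lift r μ (suc u) = r zero * μ u

lift-· : (r : Vector ℚ (suc n)) (μ : Vector ℚ n) (s : Vector ℚ (suc n)) →
         lift r μ · s ≡ μ · eliminate r s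
lift-· r μ s = begin
  - (μ · tail r) * s zero + (λ u → r zero * μ u) · tail s
    ≡⟨ cong (- (μ · tail r) * s zero +_) (·-scaleˡ (r zero) μ (tail s)) ⟩
  - (μ · tail r) * s zero + r zero * (μ · tail s)
    ≡⟨ solve 4 (λ a b c d → :- a :* b :+ c :* d := c :* d :+ :- b :* a) refl
               (μ · tail r) (s zero) (r zero) (μ · tail s) ⟩
  r zero * (μ · tail s) + - s zero * (μ · tail r)
    ≡⟨ sym (·-linear μ (r zero) (tail s) (- s zero) (tail r)) ⟩
  μ · eliminate r s ∎

lift-solves-pivot : (r : Vector ℚ (suc n)) (μ : Vector ℚ n) → lift r μ · r ≡ 0ℚ
lift-solves-pivot r μ = begin
  lift r μ · r          ≡⟨ lift-· r μ r ⟩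
  μ · eliminate r r     ≡⟨ sum-cong-≗ (λ u → cong (μ u *_) (cancel (r zero) (r (suc u)))) ⟩
  μ · (λ _ → 0ℚ)        ≡⟨ ·-zeroʳ μ ⟩
  0ℚ                    ∎
  where
  cancel : ∀ a b → a * b + - a * b ≡ 0ℚ
  cancel = solve 2 (λ a b → a :* b :+ :- a :* b := con 0ℚ) refl

lift-nontrivial : (r : Vector ℚ (suc n)) (μ : Vector ℚ n) → r zero ≢ 0ℚ →
                  ¬ (∀ u → μ u ≡ 0ℚ) → ¬ (∀ u → lift r μ u ≡ 0ℚ)
lift-nontrivial r μ r₀≢0 μ≢0 lift≡0 = μ≢0 (λ u → a*b≡0⇒b≡0 r₀≢0 (lift≡0 (suc u)))

NontrivialSolution : List (Vector ℚ n) → Set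
NontrivialSolution {n} rows = ∃[ x ] All (λ r → x · r ≡ 0ℚ) rows × ¬ (∀ u → x u ≡ 0ℚ)

pivot-step : (rows : List (Vector ℚ (suc n))) (pivot : Any (λ r → r zero ≢ 0ℚ) rows) →
             NontrivialSolution (map (eliminate (Any.lookup pivot)) (rows ─ pivot)) →
             NontrivialSolution rows
pivot-step rows pivot (μ , μ-solves , μ≢0) =
  lift r μ ,
  ─⁻ pivot (lift-solves-pivot r μ) (All.map (λ {s} → trans (lift-· r μ s)) (map⁻ μ-solves)) ,
  lift-nontrivial r μ (lookup-result pivot) μ≢0
  where
  r = Any.lookup pivot

underdetermined⇒nontrivialSolution : (rows : List (Vector ℚ (suc n))) → length rows ≤ n →
                                     NontrivialSolution rows
underdetermined⇒nontrivialSolution rows len with any? (λ r → ¬? (r zero ≟ 0ℚ)) rows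
... | no noPivot = δ zero , All.map (λ {r} → solves r) (¬Any⇒All¬ rows noPivot) , λ δ≡0 → 1≢0 (δ≡0 zero)
  where
  solves : ∀ r → ¬ ¬ r zero ≡ 0ℚ → δ zero · r ≡ 0ℚ
  solves r r₀≡0 = trans (·-comm (δ zero) r) (trans (·-δ r zero) (decidable-stable (r zero ≟ 0ℚ) r₀≡0))
underdetermined⇒nontrivialSolution {zero}  []      _   | yes ()
underdetermined⇒nontrivialSolution {zero}  (_ ∷ _) ()  | yes _
underdetermined⇒nontrivialSolution {suc n} rows    len | yes pivot =
  pivot-step rows pivot (underdetermined⇒nontrivialSolution reduced reduced≤n)
  where
  reduced = map (eliminate (Any.lookup pivot)) (rows ─ pivot)
  reduced≤n : length reduced ≤ n
  reduced≤n rewrite length-map (eliminate (Any.lookup pivot)) (rows ─ pivot) =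
    s≤s⁻¹ (subst (_≤ suc n) (length-removeAt′ rows (Any.index pivot)) len)

tabulate∁ : {A : Set} → Subset n → (Fin n → A) → List A
tabulate∁ []             f = []
tabulate∁ (inside  ∷ s) f = tabulate∁ s (f ∘ suc)
tabulate∁ (outside ∷ s) f = f zero ∷ tabulate∁ s (f ∘ suc)

length-tabulate∁ : {A : Set} (s : Subset n) (f : Fin n → A) → length (tabulate∁ s f) ℕ.+ ∣ s ∣ ≡ n
length-tabulate∁ []             f = refl
length-tabulate∁ (inside  ∷ s) f = trans (ℕₚ.+-suc _ ∣ s ∣) (cong suc (length-tabulate∁ s (f ∘ suc)))
length-tabulate∁ (outside ∷ s) f = cong suc (length-tabulate∁ s (f ∘ suc))

tabulate∁⁻ : {A : Set} {P : A → Set} (s : Subset n) {f : Fin n → A} →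
             All P (tabulate∁ s f) → ∀ p → p ∉ s → P (f p)
tabulate∁⁻ (inside  ∷ s) ps        zero    p∉ = contradiction here p∉
tabulate∁⁻ (outside ∷ s) (px ∷ _)  zero    _  = px
tabulate∁⁻ (inside  ∷ s) ps        (suc p) p∉ = tabulate∁⁻ s ps p (p∉ ∘ there)
tabulate∁⁻ (outside ∷ s) (_ ∷ ps)  (suc p) p∉ = tabulate∁⁻ s ps p (p∉ ∘ there)

anyFin-false : (f : Fin n → Bool) → (∀ q → f q ≡ false) → anyFin f ≡ false
anyFin-false {zero}  f f≡false = refl
anyFin-false {suc n} f f≡false rewrite f≡false zero = anyFin-false (f ∘ suc) (f≡false ∘ suc)

lookup∧≡false : (s : Subset n) (q : Fin n) {b : Bool} → (q ∈ s → b ≡ false) → lookup s q ∧ b ≡ false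
lookup∧≡false s q b≡false with lookup s q in eq
... | false = refl
... | true  = b≡false (lookup⇒[]= q s eq)

lookup≡false⇒∉ : (s : Subset n) (q : Fin n) → lookup s q ≡ false → q ∉ s
lookup≡false⇒∉ s q eq q∈s = contradiction (trans (sym eq) ([]=⇒lookup q∈s)) λ ()

module _ {d : ℕ} (v : Fin (suc d) → Point d) (σ : Subset (suc d)) {i : Fin d} where

  inS-constant : ∀ c → (∀ q → q ∈ σ → v q i ≡ c) → inS v σ i ≡ false
  inS-constant false const =
    cong (_∧ anyFin (λ q → lookup σ q ∧ not (v q i))) (anyFin-false _ (λ q → lookup∧≡false σ q (const q)))
  inS-constant true  const =
    trans (cong (anyFin (λ q → lookup σ q ∧ v q i) ∧_)
                (anyFin-false _ (λ q → lookup∧≡false σ q (cong not ∘ const q))))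
          (∧-zeroʳ _)

  proj-constant : ∀ c x → (∀ q → q ∈ σ → v q i ≡ c) → proj v σ x i ≡ x i
  proj-constant c x const = cong (λ b → if b then false else x i) (inS-constant c const)

coordinateRow : {m d : ℕ} → (Fin m → Point d) → Fin d → Vector ℚ m
coordinateRow v i q = bit (v q i)

NontrivialAffineDependence : {m d : ℕ} → (Fin m → Point d) → Set
NontrivialAffineDependence v =
  ∃[ x ] (x · (λ _ → 1ℚ) ≡ 0ℚ × (∀ i → x · coordinateRow v i ≡ 0ℚ)) × ¬ (∀ q → x q ≡ 0ℚ)

affinelyIndependent⇒¬dependence : {m d : ℕ} (v : Fin m → Point d) →
                                  AffinelyIndependent v → ¬ NontrivialAffineDependence v
affinelyIndependent⇒¬dependence v indep (x , (sum≡0 , coords≡0) , x≢0) = x≢0 (indep x sumℚ≡0 sumℚ-coords≡0)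
  where
  sumℚ≡0 : sumℚ x ≡ 0ℚ
  sumℚ≡0 = begin
    sumℚ x           ≡⟨ sumℚ≡sum x ⟩
    sum x            ≡⟨ sum-cong-≗ (sym ∘ *-identityʳ ∘ x) ⟩
    x · (λ _ → 1ℚ)   ≡⟨ sum≡0 ⟩
    0ℚ               ∎
  sumℚ-coords≡0 : ∀ i → sumℚ (λ q → x q * bit (v q i)) ≡ 0ℚ
  sumℚ-coords≡0 i = trans (sumℚ≡sum (λ q → x q * bit (v q i))) (coords≡0 i)

module Collision {d : ℕ} (v : Fin (suc d) → Point d) (σ : Subset (suc d)) (k l : Fin (suc d)) where

  outsideσ : Vector ℚ (suc d)
  outsideσ q = bit (not (lookup σ q))

  vertexRow : Fin (suc d) → Vector ℚ (suc d)
  vertexRow p with p ≟ᶠ l | p ≟ᶠ k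
  ... | yes _ | _     = λ _ → 1ℚ
  ... | no _  | yes _ = outsideσ
  ... | no _  | no _  = δ p

  vertexRow-l : vertexRow l ≡ λ _ → 1ℚ
  vertexRow-l with l ≟ᶠ l
  ... | yes _   = refl
  ... | no l≢l  = contradiction refl l≢l

  vertexRow-k : k ≢ l → vertexRow k ≡ outsideσ
  vertexRow-k k≢l with k ≟ᶠ l | k ≟ᶠ k
  ... | yes k≡l | _       = contradiction k≡l k≢l
  ... | no _    | yes _   = refl
  ... | no _    | no k≢k  = contradiction refl k≢k

  vertexRow-other : ∀ {p} → p ≢ l → p ≢ k → vertexRow p ≡ δ p
  vertexRow-other {p} p≢l p≢k with p ≟ᶠ l | p ≟ᶠ k
  ... | yes p≡l | _       = contradiction p≡l p≢l
  ... | no _    | yes p≡k = contradiction p≡k p≢k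
  ... | no _    | no _    = refl

  pinned-coordinate : {x : Vector ℚ (suc d)} {i : Fin d} (c : Bool) →
    x · (λ _ → 1ℚ) ≡ 0ℚ → x · outsideσ ≡ 0ℚ →
    (∀ p → p ∉ σ → p ≢ k → p ≢ l → x p ≡ 0ℚ) →
    (∀ q → q ∈ σ → v q i ≡ c) → v l i ≡ v k i →
    x · coordinateRow v i ≡ 0ℚ
  pinned-coordinate {x} {i} c sum≡0 outside≡0 off≡0 const vl≡vk = begin
    x · coordinateRow v i                      ≡⟨ sum-cong-≗ split ⟩
    x · (λ q → β * 1ℚ + γ * outsideσ q)        ≡⟨ ·-linear x β (λ _ → 1ℚ) γ outsideσ ⟩
    β * (x · (λ _ → 1ℚ)) + γ * (x · outsideσ)  ≡⟨ cong₂ (λ s t → β * s + γ * t) sum≡0 outside≡0 ⟩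
    β * 0ℚ + γ * 0ℚ                            ≡⟨ solve 2 (λ b g → b :* con 0ℚ :+ g :* con 0ℚ := con 0ℚ) refl β γ ⟩
    0ℚ                                         ∎
    where
    β = bit c
    γ = bit (v k i) - β
    on : ∀ b g → b * 1ℚ + g * 0ℚ ≡ b
    on = solve 2 (λ b g → b :* con 1ℚ :+ g :* con 0ℚ := b) refl
    off : ∀ b a → b * 1ℚ + (a - b) * 1ℚ ≡ a
    off = solve 2 (λ b a → b :* con 1ℚ :+ (a :- b) :* con 1ℚ := a) refl
    split : ∀ q → x q * bit (v q i) ≡ x q * (β * 1ℚ + γ * outsideσ q)
    split q with lookup σ q in q∈?σ
    ... | true  = cong (x q *_) (trans (cong bit (const q (lookup⇒[]= q σ q∈?σ))) (sym (on β γ)))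
    ... | false with q ≟ᶠ k | q ≟ᶠ l
    ...   | yes refl | _        = cong (x q *_) (sym (off β (bit (v q i))))
    ...   | no _     | yes refl = cong (x q *_) (trans (cong bit vl≡vk) (sym (off β (bit (v k i)))))
    ...   | no q≢k   | no q≢l   rewrite off≡0 q (lookup≡false⇒∉ σ q q∈?σ) q≢k q≢l =
            trans (*-zeroˡ (bit (v q i))) (sym (*-zeroˡ (β * 1ℚ + γ * 1ℚ)))

  constraints : Subset d → List (Vector ℚ (suc d))
  constraints T = tabulate∁ σ vertexRow ++ tabulate∁ T (coordinateRow v)

  length-constraints : ∀ {j} (T : Subset d) → ∣ σ ∣ ≡ suc j → ∣ T ∣ ℕ.+ j ≡ d → length (constraints T) ≡ d
  length-constraints {j} T ∣σ∣≡1+j ∣T∣+j≡d = begin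
    length (vertexRows ++ coordinateRows)        ≡⟨ length-++ vertexRows ⟩
    length vertexRows ℕ.+ length coordinateRows  ≡⟨ cong (length vertexRows ℕ.+_) coordinateRows≡j ⟩
    length vertexRows ℕ.+ j                      ≡⟨ vertexRows+j≡d ⟩
    d                                            ∎
    where
    vertexRows = tabulate∁ σ vertexRow
    coordinateRows = tabulate∁ T (coordinateRow v)
    vertexRows+j≡d : length vertexRows ℕ.+ j ≡ d
    vertexRows+j≡d = ℕₚ.suc-injective (begin
      suc (length vertexRows ℕ.+ j)  ≡⟨ ℕₚ.+-suc (length vertexRows) j ⟨
      length vertexRows ℕ.+ suc j    ≡⟨ cong (length vertexRows ℕ.+_) ∣σ∣≡1+j ⟨
      length vertexRows ℕ.+ ∣ σ ∣    ≡⟨ length-tabulate∁ σ vertexRow ⟩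
      suc d                          ∎)
    coordinateRows≡j : length coordinateRows ≡ j
    coordinateRows≡j = ℕₚ.+-cancelˡ-≡ ∣ T ∣ (length coordinateRows) j (begin
      ∣ T ∣ ℕ.+ length coordinateRows  ≡⟨ ℕₚ.+-comm ∣ T ∣ (length coordinateRows) ⟩
      length coordinateRows ℕ.+ ∣ T ∣  ≡⟨ length-tabulate∁ T (coordinateRow v) ⟩
      d                                ≡⟨ ∣T∣+j≡d ⟨
      ∣ T ∣ ℕ.+ j                      ∎)

  module _ (k≢l : k ≢ l) (k∉σ : k ∉ σ) (l∉σ : l ∉ σ) (T : Subset d) (b : Point d)
           (pinned : ∀ q → q ∈ σ → ∀ i → i ∈ T → v q i ≡ b i)
           (agree : ∀ i → i ∈ T → v l i ≡ v k i) where

    solution⇒dependence : (x : Vector ℚ (suc d)) → All (λ r → x · r ≡ 0ℚ) (constraints T) →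
                          x · (λ _ → 1ℚ) ≡ 0ℚ × (∀ i → x · coordinateRow v i ≡ 0ℚ)
    solution⇒dependence x solves = sum≡0 , coords≡0
      where
      vertexRowsSolved : ∀ p → p ∉ σ → x · vertexRow p ≡ 0ℚ
      vertexRowsSolved = tabulate∁⁻ σ (++⁻ˡ (tabulate∁ σ vertexRow) solves)
      sum≡0 : x · (λ _ → 1ℚ) ≡ 0ℚ
      sum≡0 = subst (λ r → x · r ≡ 0ℚ) vertexRow-l (vertexRowsSolved l l∉σ)
      outside≡0 : x · outsideσ ≡ 0ℚ
      outside≡0 = subst (λ r → x · r ≡ 0ℚ) (vertexRow-k k≢l) (vertexRowsSolved k k∉σ)
      off≡0 : ∀ p → p ∉ σ → p ≢ k → p ≢ l → x p ≡ 0ℚ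
      off≡0 p p∉σ p≢k p≢l =
        trans (sym (·-δ x p)) (subst (λ r → x · r ≡ 0ℚ) (vertexRow-other p≢l p≢k) (vertexRowsSolved p p∉σ))
      coords≡0 : ∀ i → x · coordinateRow v i ≡ 0ℚ
      coords≡0 i with i ∈? T
      ... | yes i∈T = pinned-coordinate (b i) sum≡0 outside≡0 off≡0 (λ q q∈σ → pinned q q∈σ i i∈T) (agree i i∈T)
      ... | no  i∉T = tabulate∁⁻ T (++⁻ʳ (tabulate∁ σ vertexRow) solves) i i∉T

    collision⇒dependence : ∀ {j} → ∣ σ ∣ ≡ suc j → ∣ T ∣ ℕ.+ j ≡ d → NontrivialAffineDependence v
    collision⇒dependence ∣σ∣≡1+j ∣T∣+j≡d
      with underdetermined⇒nontrivialSolution (constraints T)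
             (ℕₚ.≤-reflexive (length-constraints T ∣σ∣≡1+j ∣T∣+j≡d))
    ... | x , solves , x≢0 = x , solution⇒dependence x solves , x≢0

mainTheorem9 : (d : ℕ) (v : Fin (suc d) → Point d) → NondegenerateSimplex d v →
    (j : ℕ) → j ≤ d → (σ : Subset (suc d)) → IsFace {d} j σ → IsExterior v j σ →
    ∀ (k l : Fin (suc d)) → k ∉ σ → l ∉ σ →
    proj v σ (v k) ≡ proj v σ (v l) → k ≡ l
mainTheorem9 d v indep j _ σ face (T , ∣T∣+j≡d , b , pinned) k l k∉σ l∉σ πk≡πl with k ≟ᶠ l
... | yes k≡l = k≡l
... | no  k≢l = contradiction (collision⇒dependence k≢l k∉σ l∉σ T b pinned agree face ∣T∣+j≡d)
                              (affinelyIndependent⇒¬dependence v indep)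
  where
  open Collision v σ k l
  πσ-fixes : ∀ {i} x → i ∈ T → proj v σ x i ≡ x i
  πσ-fixes {i} x i∈T = proj-constant v σ (b i) x (λ q q∈σ → pinned q q∈σ i i∈T)
  agree : ∀ i → i ∈ T → v l i ≡ v k i
  agree i i∈T = begin
    v l i              ≡⟨ πσ-fixes (v l) i∈T ⟨
    proj v σ (v l) i   ≡⟨ cong-app πk≡πl i ⟨
    proj v σ (v k) i   ≡⟨ πσ-fixes (v k) i∈T ⟩
    v k i              ∎
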